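{- Let $m>1$ be an integer and let $(a,b,c)$ be an $m$-Markoff triple such that either $(a,b,c)$ or $(b,a,c)$ is minimal. Then at least one of $b$ or $c-3ab$ is less than or equal to $\sqrt{\frac{m-a^2}{3a+2}}$.
   Context: An $m$-Markoff triple is a triple $(a,b,c)$ of positive integers with $a^2+b^2+c^2=3abc+m$. A minimal triple is an $m$-Markoff triple $(x,y,z)$ with $x\le y\le z$ and $3xy-z\le 0$. -}

module Defs where

open import Data.Integer using (ℤ; +_; _+_; _-_; _*_; _≤_)
open import Data.Product using (_×_)
open import Data.Sum using (_⊎_)
open import Relation.Binary.PropositionalEquality using (_≡_)

record MarkoffTriple (m : ℤ) (a b c : ℤ) : Set where
  field
    a-pos : + 1 ≤ a
    b-pos : + 1 ≤ b
    c-pos : + 1 ≤ c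
    eqn   : a * a + b * b + c * c ≡ + 3 * a * b * c + m

Minimal : ℤ → ℤ → ℤ → ℤ → Set
Minimal m x y z = MarkoffTriple m x y z × (x ≤ y) × (y ≤ z) × (+ 3 * x * y - z ≤ + 0)

-- For an integer x, numerator N and positive denominator D,
-- "x ≤ √(N / D)" in the reals: the radicand is nonnegative (N ≥ 0) and
-- either x ≤ 0 (so x ≤ √(..) trivially) or x² · D ≤ N (x > 0, square both sides).
LeSqrtFrac : ℤ → ℤ → ℤ → Set
LeSqrtFrac x N D = (+ 0 ≤ N) × (x ≤ + 0 ⊎ x * x * D ≤ N)

{-# OPTIONS --safe #-}
-- Put d = c − 3ab. The Markoff equation rewrites as m − a² = b² + d² + 3abd, a
-- quadratic form symmetric in b and d. If x is the smaller of b and d and y the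
-- larger, this form minus (3a + 2)x² factors as (y − x)(y + x + 3ax) ≥ 0, so
-- (3a + 2)x² ≤ m − a². Minimality (in either order of a, b) gives 3ab ≤ c, i.e. d ≥ 0.
module Submission where

open import Defs
open import Data.Integer using (ℤ; +_; 0ℤ; _+_; _-_; _*_; _≤_; _<_; +≤+)
open import Data.Integer.Properties
  using (pos-*; nonNegative⁻¹; +-mono-≤; ≤-trans; ≤-total; i≤j⇒0≤j-i; 0≤i-j⇒j≤i; i-j≤0⇒i≤j)
open import Data.Integer.Tactic.RingSolver using (solve-∀)
open import Data.Nat using (z≤n)
open import Data.Sum using (_⊎_; inj₁; inj₂)
open import Data.Product using (_,_)
open import Relation.Binary.PropositionalEquality using (_≡_; sym; cong; subst; module ≡-Reasoning)

markoffForm : ℤ → ℤ → ℤ → ℤ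
markoffForm a x y = x * x + y * y + + 3 * a * x * y

0≤i*j : ∀ {i j} → 0ℤ ≤ i → 0ℤ ≤ j → 0ℤ ≤ i * j
0≤i*j {+ m} {+ n} _ _ rewrite sym (pos-* m n) = +≤+ z≤n

markoffForm-nonNeg : ∀ {a x y} → 0ℤ ≤ a → 0ℤ ≤ x → 0ℤ ≤ y → 0ℤ ≤ markoffForm a x y
markoffForm-nonNeg 0≤a 0≤x 0≤y =
  +-mono-≤ (+-mono-≤ (0≤i*j 0≤x 0≤x) (0≤i*j 0≤y 0≤y))
           (0≤i*j (0≤i*j (0≤i*j (nonNegative⁻¹ (+ 3)) 0≤a) 0≤x) 0≤y)

markoffForm-comm : ∀ a x y → markoffForm a x y ≡ markoffForm a y x
markoffForm-comm = expanded
  where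
  -- solve-∀ does not unfold markoffForm, so the identity is stated expanded.
  expanded : ∀ a x y → x * x + y * y + + 3 * a * x * y ≡ y * y + x * x + + 3 * a * y * x
  expanded = solve-∀

markoffForm-minus-scaled-square : ∀ a x y →
  markoffForm a x y - x * x * (+ 3 * a + + 2) ≡ (y - x) * (y + x + + 3 * a * x)
markoffForm-minus-scaled-square = expanded
  where
  expanded : ∀ a x y →
    (x * x + y * y + + 3 * a * x * y) - x * x * (+ 3 * a + + 2) ≡ (y - x) * (y + x + + 3 * a * x)
  expanded = solve-∀

smaller-le-sqrt-markoffForm : ∀ {a x y} → 0ℤ ≤ a → 0ℤ ≤ x → x ≤ y →
  LeSqrtFrac x (markoffForm a x y) (+ 3 * a + + 2)
smaller-le-sqrt-markoffForm {a} {x} {y} 0≤a 0≤x x≤y =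
  markoffForm-nonNeg 0≤a 0≤x 0≤y ,
  inj₂ (0≤i-j⇒j≤i (subst (0ℤ ≤_) (sym (markoffForm-minus-scaled-square a x y)) 0≤product))
  where
  0≤y : 0ℤ ≤ y
  0≤y = ≤-trans 0≤x x≤y
  0≤product : 0ℤ ≤ (y - x) * (y + x + + 3 * a * x)
  0≤product = 0≤i*j (i≤j⇒0≤j-i x≤y)
                    (+-mono-≤ (+-mono-≤ 0≤y 0≤x) (0≤i*j (0≤i*j (nonNegative⁻¹ (+ 3)) 0≤a) 0≤x))

le-sqrt-markoffForm : ∀ {a x y} → 0ℤ ≤ a → 0ℤ ≤ x → 0ℤ ≤ y →
  LeSqrtFrac x (markoffForm a x y) (+ 3 * a + + 2) ⊎ LeSqrtFrac y (markoffForm a x y) (+ 3 * a + + 2)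
le-sqrt-markoffForm {a} {x} {y} 0≤a 0≤x 0≤y with ≤-total x y
... | inj₁ x≤y = inj₁ (smaller-le-sqrt-markoffForm 0≤a 0≤x x≤y)
... | inj₂ y≤x = inj₂ (subst (λ N → LeSqrtFrac y N (+ 3 * a + + 2)) (markoffForm-comm a y x)
                         (smaller-le-sqrt-markoffForm 0≤a 0≤y y≤x))

markoff-radicand : ∀ {m a b c} → MarkoffTriple m a b c →
  m - a * a ≡ markoffForm a b (c - + 3 * a * b)
markoff-radicand {m} {a} {b} {c} T = begin
  m - a * a                                          ≡⟨ isolate-m m a b c ⟩
  ((+ 3 * a * b * c + m) - + 3 * a * b * c) - a * a  ≡⟨ cong (λ t → (t - + 3 * a * b * c) - a * a) (sym (MarkoffTriple.eqn T)) ⟩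
  ((a * a + b * b + c * c) - + 3 * a * b * c) - a * a ≡⟨ complete-square a b c ⟩
  markoffForm a b (c - + 3 * a * b)                  ∎
  where
  open ≡-Reasoning
  isolate-m : ∀ m a b c → m - a * a ≡ ((+ 3 * a * b * c + m) - + 3 * a * b * c) - a * a
  isolate-m = solve-∀
  complete-square : ∀ a b c → ((a * a + b * b + c * c) - + 3 * a * b * c) - a * a
    ≡ b * b + (c - + 3 * a * b) * (c - + 3 * a * b) + + 3 * a * b * (c - + 3 * a * b)
  complete-square = solve-∀

minimal-3ab≤c : ∀ {m a b c} → Minimal m a b c ⊎ Minimal m b a c → + 3 * a * b ≤ c
minimal-3ab≤c (inj₁ (_ , _ , _ , 3ab-c≤0)) = i-j≤0⇒i≤j 3ab-c≤0
minimal-3ab≤c {a = a} {b} {c} (inj₂ (_ , _ , _ , 3ba-c≤0)) =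
  i-j≤0⇒i≤j (subst (λ t → t - c ≤ 0ℤ) (3ba≡3ab a b) 3ba-c≤0)
  where
  3ba≡3ab : ∀ a b → + 3 * b * a ≡ + 3 * a * b
  3ba≡3ab = solve-∀

positive⇒nonNeg : ∀ {i} → + 1 ≤ i → 0ℤ ≤ i
positive⇒nonNeg = ≤-trans (+≤+ z≤n)

lemma2p3 : (m a b c : ℤ) → + 1 < m → MarkoffTriple m a b c →
    (Minimal m a b c ⊎ Minimal m b a c) →
    LeSqrtFrac b (m - a * a) (+ 3 * a + + 2) ⊎
      LeSqrtFrac (c - + 3 * a * b) (m - a * a) (+ 3 * a + + 2)
lemma2p3 m a b c _ T minimal
  rewrite markoff-radicand T =
  le-sqrt-markoffForm (positive⇒nonNeg (MarkoffTriple.a-pos T)) (positive⇒nonNeg (MarkoffTriple.b-pos T))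
                      (i≤j⇒0≤j-i (minimal-3ab≤c minimal))
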